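{- For all positive integers $d$ and all $(x_1,x_2,\ldots,x_d)\in\mathbb{N}^d$, $$m^d\leq r_d(x_1,x_2,\ldots,x_d)<(m+1)^d,\qquad\text{where } m=\max(x_1,x_2,\ldots,x_d).$$
   Context: $\mathbb{N}$ denotes the set of non-negative integers. The Rosenberg-Strong $d$-tupling function $r_d\colon\mathbb{N}^d\to\mathbb{N}$ is defined recursively by $r_1(x_1)=x_1$ and, for integers $d>1$, $r_d(x_1,\ldots,x_{d-1},x_d)=r_{d-1}(x_1,\ldots,x_{d-1})+m^d+(m-x_d)\bigl((m+1)^{d-1}-m^{d-1}\bigr)$, where $m=\max(x_1,\ldots,x_d)$. -}

module Defs where

open import Data.Nat using (ℕ; zero; suc; _+_; _*_; _∸_; _^_; _⊔_)
open import Data.Vec using (Vec; []; _∷_; init; last; foldr)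

maxV : ∀ {n} → Vec ℕ (suc n) → ℕ
maxV (x ∷ xs) = foldr _ _⊔_ x xs

-- Rosenberg-Strong d-tupling function, d = suc n, tuple (x_1,...,x_d).
-- r_1(x_1) = x_1
-- r_d(x_1..x_d) = r_{d-1}(x_1..x_{d-1}) + m^d + (m - x_d)((m+1)^{d-1} - m^{d-1})
rs : ∀ n → Vec ℕ (suc n) → ℕ
rs zero (x ∷ []) = x
rs (suc n) xs =
  let m = maxV xs
      d = suc (suc n)
  in rs n (init xs) + m ^ d + (m ∸ last xs) * ((suc m) ^ suc n ∸ m ^ suc n)

module Submission where

-- For d + 1, write r = r_d(init x), A = (m+1)^d, B = m^d and k = m - x_{d+1},
-- so that  r_{d+1}(x) = r + m·B + k·(A - B).
--   * Lower bound: the middle summand m·B = m^{d+1} is already present.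
--   * Upper bound: the maximum of the initial segment init x is at most m,
--     so by induction r < (max(init x)+1)^d ≤ A.  Together with B ≤ A and
--     k ≤ m, the arithmetic inequality `sum-bound` gives
--     r + m·B + k·(A - B) < A + m·B + m·(A - B) = (m+1)·A = (m+1)^{d+1}.

open import Defs
open import Data.Nat using (ℕ; zero; suc; s≤s; _+_; _*_; _∸_; _^_; _⊔_; _≤_; _<_)
open import Data.Vec using (Vec; []; _∷_; init; last; foldr)
open import Data.Product using (_×_; _,_; proj₂)
open import Data.Nat.Properties
open import Relation.Binary.PropositionalEquality using (cong; sym)

fold-⊔-init : ∀ k (ys : Vec ℕ (suc k)) (e : ℕ) →
              foldr _ _⊔_ e (init ys) ≤ foldr _ _⊔_ e ys
fold-⊔-init zero    (y ∷ [])  e = m≤n⊔m y e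
fold-⊔-init (suc k) (y ∷ zs) e = ⊔-monoʳ-≤ y (fold-⊔-init k zs e)

maxV-init : ∀ n (xs : Vec ℕ (suc (suc n))) → maxV (init xs) ≤ maxV xs
maxV-init n (x ∷ ys) = fold-⊔-init n ys x

-- The arithmetic core of the upper bound: if r < A, B ≤ A and k ≤ m, then
-- r + m·B + k·(A - B) < (m+1)·A, because m·B + m·(A - B) = m·A.
sum-bound : ∀ r m k A B → r < A → B ≤ A → k ≤ m →
            r + m * B + k * (A ∸ B) < suc m * A
sum-bound r m k A B r<A B≤A k≤m = begin-strict
    r + m * B + k * (A ∸ B)  ≤⟨ +-monoʳ-≤ (r + m * B) (*-monoˡ-≤ (A ∸ B) k≤m) ⟩
    r + m * B + m * (A ∸ B)  <⟨ +-monoˡ-< (m * (A ∸ B)) (+-monoˡ-< (m * B) r<A) ⟩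
    A + m * B + m * (A ∸ B)  ≡⟨ +-assoc A (m * B) (m * (A ∸ B)) ⟩
    A + (m * B + m * (A ∸ B)) ≡⟨ cong (A +_) (sym (*-distribˡ-+ m B (A ∸ B))) ⟩
    A + m * (B + (A ∸ B))    ≡⟨ cong (λ t → A + m * t) (m+[n∸m]≡n B≤A) ⟩
    A + m * A                ∎
  where open ≤-Reasoning

lemma12 : (n : ℕ) → (xs : Vec ℕ (suc n)) →
    (maxV xs ^ suc n ≤ rs n xs) × (rs n xs < suc (maxV xs) ^ suc n)
lemma12 zero (x ∷ []) rewrite *-identityʳ x = ≤-refl , ≤-refl
lemma12 (suc n) xs = lower , upper
  where
  m = maxV xs
  r = rs n (init xs)
  k = m ∸ last xs

  lower : m ^ suc (suc n) ≤ r + m ^ suc (suc n) + k * (suc m ^ suc n ∸ m ^ suc n)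
  lower = ≤-trans (m≤n+m (m ^ suc (suc n)) r) (m≤m+n _ _)

  -- Induction hypothesis, weakened from max(init x) to m.
  r<A : r < suc m ^ suc n
  r<A = <-≤-trans (proj₂ (lemma12 n (init xs)))
                  (^-monoˡ-≤ (suc n) (s≤s (maxV-init n xs)))

  upper : r + m ^ suc (suc n) + k * (suc m ^ suc n ∸ m ^ suc n) < suc m ^ suc (suc n)
  upper = sum-bound r m k (suc m ^ suc n) (m ^ suc n) r<A
                    (^-monoˡ-≤ (suc n) (n≤1+n m)) (m∸n≤m m (last xs))
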